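{- Let $P$ and $Q$ be finite posets whose comparability graphs are isomorphic. Then $\#\mathrm{PP}^{\ell}_e(P)=\#\mathrm{PP}^{\ell}_e(Q)$ for all integers $\ell\geq 1$ and $e\geq 0$.
   Context: The comparability graph of a poset is the simple graph on its elements in which distinct elements are adjacent iff comparable. A set-valued $P$-partition of height $\ell$ is a map $T$ from $P$ to the set of nonempty subsets of $\{0,1,\ldots,\ell\}$ such that $\max(T(p))\leq\min(T(q))$ whenever $p\leq q$ in $P$. Its excess is $\sum_{p\in P}(\#T(p)-1)$. $\mathrm{PP}^{\ell}_e(P)$ denotes the set of set-valued $P$-partitions of height $\ell$ and excess $e$. -}

module Defs where

open import Level using (0ℓ)
open import Data.Bool using (true; false)
open import Data.Nat using (ℕ; zero; suc; _∸_)
open import Data.Nat.ListAction using (sum)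
open import Data.Fin using (Fin; _≤_)
open import Data.Fin.Properties using (all?) renaming (_≤?_ to _≤ᶠ?_; _≟_ to _≟ᶠ_)
open import Data.Fin.Subset using (Subset; _∈_; ∣_∣; Nonempty)
open import Data.Fin.Subset.Properties using (_∈?_; nonempty?)
open import Data.List using (List; []; _∷_; map; allFin; length; filter; cartesianProductWith)
open import Data.Vec using (Vec; lookup)
import Data.Vec as V
open import Data.Product using (Σ; _×_; _,_)
open import Data.Sum using (_⊎_)
open import Relation.Nullary using (¬_; ¬?; Dec; yes; no)
open import Relation.Nullary.Decidable using (_×-dec_; _→-dec_)
open import Relation.Binary using (Rel; Decidable; IsPartialOrder)
open import Relation.Binary.PropositionalEquality using (_≡_)
open import Function.Bundles using (_↔_; Inverse)
import Data.Nat.Properties as ℕP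

record FinPoset (n : ℕ) : Set₁ where
  field
    _≼_ : Rel (Fin n) 0ℓ
    isPartialOrder : IsPartialOrder _≡_ _≼_
    _≼?_ : Decidable _≼_

open FinPoset public

Comparable : ∀ {n} → FinPoset n → Fin n → Fin n → Set
Comparable P x y = _≼_ P x y ⊎ _≼_ P y x

ComparabilityIso : ∀ {n m} → FinPoset n → FinPoset m → Set
ComparabilityIso {n} {m} P Q =
  Σ (Fin n ↔ Fin m) λ f →
    ∀ x y → ¬ (x ≡ y) →
      ((Comparable P x y → Comparable Q (Inverse.to f x) (Inverse.to f y))
      × (Comparable Q (Inverse.to f x) (Inverse.to f y) → Comparable P x y))

-- A map T : P → subsets of {0,…,ℓ} = Fin (suc ℓ), stored as a vector (T p = lookup T p).
SetMap : ℕ → ℕ → Set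
SetMap n ℓ = Vec (Subset (suc ℓ)) n

-- max A ≤ min B (for nonempty A, B), written out: every element of A is ≤ every element of B.
MaxLeMin : ∀ {ℓ} → Subset (suc ℓ) → Subset (suc ℓ) → Set
MaxLeMin A B = ∀ i j → i ∈ A → j ∈ B → i ≤ j

IsSetValuedPPartition : ∀ {n} (ℓ : ℕ) → FinPoset n → SetMap n ℓ → Set
IsSetValuedPPartition {n} ℓ P T =
  (∀ p → Nonempty (lookup T p))
  × (∀ p q → ¬ (p ≡ q) → _≼_ P p q → MaxLeMin (lookup T p) (lookup T q))

excess : ∀ {n ℓ} → SetMap n ℓ → ℕ
excess {n} T = sum (map (λ p → ∣ lookup T p ∣ ∸ 1) (allFin n))

InPP : ∀ {n} (ℓ e : ℕ) → FinPoset n → SetMap n ℓ → Set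
InPP ℓ e P T = IsSetValuedPPartition ℓ P T × (excess T ≡ e)

inPP? : ∀ {n} (ℓ e : ℕ) (P : FinPoset n) (T : SetMap n ℓ) → Dec (InPP ℓ e P T)
inPP? ℓ e P T =
  (all? (λ p → nonempty? (lookup T p))
   ×-dec all? (λ p → all? (λ q → ¬? (p ≟ᶠ q) →-dec (_≼?_ P p q →-dec
           all? (λ i → all? (λ j → (i ∈? lookup T p) →-dec ((j ∈? lookup T q) →-dec (i ≤ᶠ? j))))))))
  ×-dec (excess T ℕP.≟ e)

allSubsets : (k : ℕ) → List (Subset k)
allSubsets zero = V.[] ∷ []
allSubsets (suc k) = cartesianProductWith V._∷_ (true ∷ false ∷ []) (allSubsets k)

allSetMaps : (n ℓ : ℕ) → List (SetMap n ℓ)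
allSetMaps zero ℓ = V.[] ∷ []
allSetMaps (suc n) ℓ = cartesianProductWith V._∷_ (allSubsets (suc ℓ)) (allSetMaps n ℓ)

#PP : ∀ {n} (ℓ e : ℕ) → FinPoset n → ℕ
#PP {n} ℓ e P = length (filter (inPP? ℓ e P) (allSetMaps n ℓ))

-- Describe a set-valued P-partition T by the least elements a, greatest elements b and
-- spreads s = b ∸ a of its blocks, and call w p = (a p ∸ max {b q | q < p}) + s p the rise
-- of p.  Then b p = w p + max {b q | q < p}, so b is the heaviest-chain function of the
-- weights w, and every chain of P has w-weight at most ℓ.  Chains are exactly the cliques of
-- the comparability graph, so the heaviest-chain function M of the same weights computed in Q
-- is also bounded by ℓ.  Translating each block T p so that its greatest element becomes M p
-- gives a set-valued Q-partition with the same block sizes, hence the same excess, and the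
-- same rises; running the construction from Q back to P therefore recovers T.  A graph
-- isomorphism between different ground sets is first absorbed by relabelling Q.
module Submission where

open import Level using (0ℓ)
open import Data.Bool using (Bool; true; false; if_then_else_; T)
open import Data.Bool.Properties using (¬-not; not-¬)
open import Data.Empty using (⊥-elim)
open import Data.Fin using (Fin; toℕ; fromℕ<)
open import Data.Fin.Induction using (po-wellFounded)
open import Data.Fin.Properties using (toℕ-fromℕ<) renaming (_≟_ to _≟ᶠ_)
open import Data.Fin.Subset using (Subset; Nonempty; ∣_∣) renaming (_∈_ to _∈ˢ_)
open import Data.List using (List; []; _∷_; map; filter; allFin; length)
open import Data.List.Extrema.Nat using (max; xs≤max; max≤v⁺; argmax-sel)
open import Data.List.Membership.Propositional using (_∈_; mapWith∈)
open import Data.List.Membership.Propositional.Properties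
  using (∈-filter⁺; ∈-filter⁻; ∈-allFin; ∈-map⁺; ∈-map⁻; ∈-cartesianProductWith⁺; mapWith∈-cong; mapWith∈≗map)
open import Data.List.Membership.Propositional.Properties.WithK using (unique∧set⇒bag)
open import Data.List.Properties using (map-cong; map-cong-local; map-∘; length-map)
open import Data.List.Relation.Binary.BagAndSetEquality using (∼bag⇒↭)
open import Data.List.Relation.Binary.Permutation.Propositional using (_↭_)
open import Data.List.Relation.Binary.Permutation.Propositional.Properties using (↭-length)
import Data.List.Relation.Binary.Permutation.Propositional.Properties as Perm
open import Data.List.Relation.Unary.All using (All; []; _∷_)
import Data.List.Relation.Unary.All as All
import Data.List.Relation.Unary.All.Properties as All
open import Data.List.Relation.Unary.AllPairs using (AllPairs; []; _∷_)
import Data.List.Relation.Unary.AllPairs as AllPairs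
open import Data.List.Relation.Unary.Any using (here; there; _─_)
open import Data.List.Relation.Unary.Unique.Propositional using (Unique)
import Data.List.Relation.Unary.Unique.Propositional.Properties as Unique
open import Data.Nat using (ℕ; zero; suc; _+_; _∸_; _≤_; _<_; _≥_; z≤n; s≤s; _≤ᵇ_; _≤?_; _<?_)
open import Data.Nat.ListAction using (sum)
open import Data.Nat.ListAction.Properties using (sum-↭)
open import Data.Nat.Properties
open import Algebra.Properties.CommutativeSemigroup +-commutativeSemigroup using (x∙yz≈y∙xz; xy∙z≈xz∙y)
open import Data.Product using (∃; _×_; _,_; proj₁; proj₂)
open import Data.Sum using (_⊎_; inj₁; inj₂)
open import Data.Unit using (tt)
open import Data.Vec using ([]; _∷_; here; there; lookup; tabulate)
open import Data.Vec.Properties using (lookup∘tabulate; tabulate-cong; tabulate∘lookup; ∷-injective)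
open import Function using (_∘_)
open import Function.Bundles using (mk⇔; _↔_; Inverse; Injection)
open import Function.Properties.Inverse using (↔-sym; ↔⇒↣)
open import Induction.WellFounded using (WellFounded; WfRec; Acc; acc)
import Induction.WellFounded as WF
open import Relation.Binary using (Rel; Symmetric; Decidable; IsPartialOrder)
import Relation.Binary.Construct.NonStrictToStrict as ToStrict
open import Relation.Binary.PropositionalEquality hiding (isPartialOrder)
open import Relation.Nullary using (¬_; yes; no; ¬?)
open import Relation.Nullary.Decidable using (_×-dec_)
open import Relation.Unary using (Pred)
import Relation.Unary as U

open import Defs

-- Finite subsets as Boolean vectors read along ℕ

at : ∀ {k} → Subset k → ℕ → Bool
at []      _       = false
at (x ∷ v) zero    = x
at (x ∷ v) (suc j) = at v j

∈⇒at : ∀ {k} {v : Subset k} {i} → i ∈ˢ v → at v (toℕ i) ≡ true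
∈⇒at here      = refl
∈⇒at (there i) = ∈⇒at i

at⇒∈ : ∀ {k} (v : Subset k) (i : Fin k) → at v (toℕ i) ≡ true → i ∈ˢ v
at⇒∈ (x ∷ v) Fin.zero    refl = here
at⇒∈ (x ∷ v) (Fin.suc i) e    = there (at⇒∈ v i e)

at⇒< : ∀ {k} (v : Subset k) j → at v j ≡ true → j < k
at⇒< (x ∷ v) zero    _ = s≤s z≤n
at⇒< (x ∷ v) (suc j) e = s≤s (at⇒< v j e)

at-≥ : ∀ {k} (v : Subset k) j → k ≤ j → at v j ≡ false
at-≥ []      j       _         = refl
at-≥ (x ∷ v) (suc j) (s≤s k≤j) = at-≥ v j k≤j

at⇒∃∈ : ∀ {k} (v : Subset k) {j} → at v j ≡ true → ∃ λ i → toℕ i ≡ j × i ∈ˢ v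
at⇒∃∈ v {j} e = i , toℕ-fromℕ< j<k , at⇒∈ v i (subst (λ j → at v j ≡ true) (sym (toℕ-fromℕ< j<k)) e)
  where
    j<k = at⇒< v j e
    i = fromℕ< j<k

at⇒nonempty : ∀ {k} (v : Subset k) {j} → at v j ≡ true → Nonempty v
at⇒nonempty v vj with at⇒∃∈ v vj
... | i , _ , i∈v = i , i∈v

nonempty⇒at : ∀ {k} {v : Subset k} → Nonempty v → ∃ λ j → at v j ≡ true
nonempty⇒at (i , i∈v) = toℕ i , ∈⇒at i∈v

at-ext : ∀ {k} (u v : Subset k) → (∀ j → j < k → at u j ≡ at v j) → u ≡ v
at-ext []      []      _ = refl
at-ext (x ∷ u) (y ∷ v) h = cong₂ _∷_ (h 0 (s≤s z≤n)) (at-ext u v (λ j j<k → h (suc j) (s≤s j<k)))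

tabulateℕ : (k : ℕ) → (ℕ → Bool) → Subset k
tabulateℕ zero    f = []
tabulateℕ (suc k) f = f 0 ∷ tabulateℕ k (λ j → f (suc j))

at-tabulateℕ : ∀ k f j → j < k → at (tabulateℕ k f) j ≡ f j
at-tabulateℕ (suc k) f zero    _         = refl
at-tabulateℕ (suc k) f (suc j) (s≤s j<k) = at-tabulateℕ k (λ j → f (suc j)) j j<k

-- Both are 0 on the empty set, and at v (greatest v) is true exactly when v is nonempty.
least : ∀ {k} → Subset k → ℕ
least []          = 0
least (true ∷ v)  = 0
least (false ∷ v) = suc (least v)

greatest : ∀ {k} → Subset k → ℕ
greatest []      = 0
greatest (x ∷ v) = if at v (greatest v) then suc (greatest v) else 0

least-at : ∀ {k} (v : Subset k) {j} → at v j ≡ true → at v (least v) ≡ true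
least-at (true ∷ v)  _       = refl
least-at (false ∷ v) {suc j} e = least-at v e

least-≤ : ∀ {k} (v : Subset k) {j} → at v j ≡ true → least v ≤ j
least-≤ (true ∷ v)  _       = z≤n
least-≤ (false ∷ v) {suc j} e = s≤s (least-≤ v e)

greatest-at : ∀ {k} (v : Subset k) {j} → at v j ≡ true → at v (greatest v) ≡ true
greatest-at (x ∷ v) {zero} e with at v (greatest v) in g
... | true  = g
... | false = e
greatest-at (x ∷ v) {suc j} e rewrite greatest-at v e = greatest-at v e

≤-greatest : ∀ {k} (v : Subset k) {j} → at v j ≡ true → j ≤ greatest v
≤-greatest (x ∷ v) {zero}  _ = z≤n
≤-greatest (x ∷ v) {suc j} e rewrite greatest-at v e = s≤s (≤-greatest v e)

least≡ : ∀ {k} (v : Subset k) {j} → at v j ≡ true → (∀ i → at v i ≡ true → j ≤ i) → least v ≡ j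
least≡ v e j≤ = ≤-antisym (least-≤ v e) (j≤ _ (least-at v e))

greatest≡ : ∀ {k} (v : Subset k) {j} → at v j ≡ true → (∀ i → at v i ≡ true → i ≤ j) → greatest v ≡ j
greatest≡ v e ≤j = ≤-antisym (≤j _ (greatest-at v e)) (≤-greatest v e)

least≤greatest : ∀ {k} (v : Subset k) {j} → at v j ≡ true → least v ≤ greatest v
least≤greatest v e = least-≤ v (greatest-at v e)

maxLeMin⇒greatest≤least : ∀ {ℓ} (A B : Subset (suc ℓ)) → Nonempty A → Nonempty B → MaxLeMin A B → greatest A ≤ least B
maxLeMin⇒greatest≤least A B neA neB A≤B
  with at⇒∃∈ A (greatest-at A (proj₂ (nonempty⇒at neA))) | at⇒∃∈ B (least-at B (proj₂ (nonempty⇒at neB)))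
... | i , i≡ga , i∈A | j , j≡lb , j∈B = subst₂ _≤_ i≡ga j≡lb (A≤B i j i∈A j∈B)

greatest≤least⇒maxLeMin : ∀ {ℓ} (A B : Subset (suc ℓ)) → greatest A ≤ least B → MaxLeMin A B
greatest≤least⇒maxLeMin A B ga≤lb i j i∈A j∈B =
  ≤-trans (≤-greatest A (∈⇒at i∈A)) (≤-trans ga≤lb (least-≤ B (∈⇒at j∈B)))

count : (ℕ → Bool) → ℕ → ℕ
count f zero    = 0
count f (suc N) = (if f 0 then 1 else 0) + count (λ i → f (suc i)) N

∣∣≡count : ∀ {k} (v : Subset k) → ∣ v ∣ ≡ count (at v) k
∣∣≡count []          = refl
∣∣≡count (true ∷ v)  = cong suc (∣∣≡count v)
∣∣≡count (false ∷ v) = ∣∣≡count v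

count-cong : ∀ {f g} N → (∀ i → i < N → f i ≡ g i) → count f N ≡ count g N
count-cong zero    _   = refl
count-cong (suc N) f≡g =
  cong₂ _+_ (cong (λ b → if b then 1 else 0) (f≡g 0 (s≤s z≤n))) (count-cong N (λ i i<N → f≡g (suc i) (s≤s i<N)))

count-+ : ∀ f m r → count f (m + r) ≡ count f m + count (λ i → f (m + i)) r
count-+ f zero    r = refl
count-+ f (suc m) r =
  trans (cong (head +_) (count-+ (λ i → f (suc i)) m r)) (sym (+-assoc head (count (λ i → f (suc i)) m) _))
  where head = if f 0 then 1 else 0

count-false : ∀ {f} N → (∀ i → i < N → f i ≡ false) → count f N ≡ 0
count-false zero    _ = refl
count-false (suc N) f≡false rewrite f≡false 0 (s≤s z≤n) = count-false N (λ i i<N → f≡false (suc i) (s≤s i<N))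

count-window : ∀ {f a r N} → (∀ j → f j ≡ true → a ≤ j × j ≤ a + r) → a + r < N →
               count f N ≡ count (λ i → f (a + i)) (suc r)
count-window {f} {a} {r} {N} support a+r<N = begin
  count f N                                       ≡⟨ cong (count f) (sym (m+[n∸m]≡n a+r+1≤N)) ⟩
  count f (a + suc r + d)                         ≡⟨ count-+ f (a + suc r) d ⟩
  count f (a + suc r) + count (λ i → f (a + suc r + i)) d
    ≡⟨ cong (count f (a + suc r) +_) (count-false d (λ i _ → false-above (a + suc r + i) (m≤m+n _ i))) ⟩
  count f (a + suc r) + 0                         ≡⟨ +-identityʳ _ ⟩
  count f (a + suc r)                             ≡⟨ count-+ f a (suc r) ⟩
  count f a + count (λ i → f (a + i)) (suc r)     ≡⟨ cong (_+ count (λ i → f (a + i)) (suc r)) (count-false a false-below) ⟩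
  count (λ i → f (a + i)) (suc r)                 ∎
  where
    open ≡-Reasoning
    a+r+1≤N : a + suc r ≤ N
    a+r+1≤N = subst (_≤ N) (sym (+-suc a r)) a+r<N
    d = N ∸ (a + suc r)
    false-below : ∀ i → i < a → f i ≡ false
    false-below i i<a = ¬-not λ fi → <⇒≱ i<a (proj₁ (support i fi))
    false-above : ∀ i → a + suc r ≤ i → f i ≡ false
    false-above i a+r<i = ¬-not λ fi → <⇒≱ (subst (_≤ i) (+-suc a r) a+r<i) (proj₂ (support i fi))

spread : ∀ {k} → Subset k → ℕ
spread v = greatest v ∸ least v

translatedAt : ∀ {k} → Subset k → ℕ → ℕ → Bool
translatedAt v c j = if c ≤ᵇ j then at v (least v + (j ∸ c)) else false

translateTo : ∀ {k} → Subset k → ℕ → Subset k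
translateTo {k} v c = tabulateℕ k (translatedAt v c)

at-translateTo-≥ : ∀ {k} (v : Subset k) {c j} → c ≤ j → j < k → at (translateTo v c) j ≡ at v (least v + (j ∸ c))
at-translateTo-≥ {k} v {c} {j} c≤j j<k rewrite at-tabulateℕ k (translatedAt v c) j j<k
  with c ≤ᵇ j in c≤ᵇj
... | true  = refl
... | false = ⊥-elim (subst T c≤ᵇj (≤⇒≤ᵇ c≤j))

at-translateTo-< : ∀ {k} (v : Subset k) {c j} → j < c → at (translateTo v c) j ≡ false
at-translateTo-< {k} v {c} {j} j<c with j <? k
... | no  j≮k = at-≥ (translateTo v c) j (≮⇒≥ j≮k)
... | yes j<k rewrite at-tabulateℕ k (translatedAt v c) j j<k
  with c ≤ᵇ j in c≤ᵇj
...   | true  = ⊥-elim (<⇒≱ j<c (≤ᵇ⇒≤ c j (subst T (sym c≤ᵇj) tt)))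
...   | false = refl

at-translateTo-+ : ∀ {k} (v : Subset k) {c i} → c + i < k → at (translateTo v c) (c + i) ≡ at v (least v + i)
at-translateTo-+ v {c} {i} c+i<k =
  trans (at-translateTo-≥ v (m≤m+n c i) c+i<k) (cong (λ t → at v (least v + t)) (m+n∸m≡n c i))

module Translation {k} (v : Subset k) {j₀} (v∋j₀ : at v j₀ ≡ true) (c : ℕ) (fits : c + spread v < k) where

  private
    a = least v
    b = greatest v
    s = spread v
    u = translateTo v c

  least+spread : a + s ≡ b
  least+spread = m+[n∸m]≡n (least≤greatest v v∋j₀)

  support : ∀ j → at v j ≡ true → a ≤ j × j ≤ a + s
  support j vj = least-≤ v vj , subst (j ≤_) (sym least+spread) (≤-greatest v vj)

  translated-support : ∀ j → at u j ≡ true → c ≤ j × j ≤ c + s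
  translated-support j uj with c ≤? j
  ... | no  c≰j = ⊥-elim (not-¬ (at-translateTo-< v (≰⇒> c≰j)) uj)
  ... | yes c≤j = c≤j , subst (_≤ c + s) (m+[n∸m]≡n c≤j) (+-monoʳ-≤ c j∸c≤s)
    where
      vj : at v (a + (j ∸ c)) ≡ true
      vj = trans (sym (at-translateTo-≥ v c≤j (at⇒< u j uj))) uj
      j∸c≤s : j ∸ c ≤ s
      j∸c≤s = +-cancelˡ-≤ a (j ∸ c) s (proj₂ (support _ vj))

  translated∋c : at u c ≡ true
  translated∋c = begin
    at u c             ≡⟨ at-translateTo-≥ v ≤-refl (≤-<-trans (m≤m+n c s) fits) ⟩
    at v (a + (c ∸ c)) ≡⟨ cong (λ t → at v (a + t)) (n∸n≡0 c) ⟩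
    at v (a + 0)       ≡⟨ cong (at v) (+-identityʳ a) ⟩
    at v a             ≡⟨ least-at v v∋j₀ ⟩
    true               ∎
    where open ≡-Reasoning

  least-translateTo : least u ≡ c
  least-translateTo = least≡ u translated∋c (λ j uj → proj₁ (translated-support j uj))

  greatest-translateTo : greatest u ≡ c + s
  greatest-translateTo = greatest≡ u u∋c+s (λ j uj → proj₂ (translated-support j uj))
    where
      u∋c+s : at u (c + s) ≡ true
      u∋c+s = trans (at-translateTo-+ v fits) (trans (cong (at v) least+spread) (greatest-at v v∋j₀))

  ∣translateTo∣ : ∣ u ∣ ≡ ∣ v ∣
  ∣translateTo∣ = begin
    ∣ u ∣                              ≡⟨ ∣∣≡count u ⟩
    count (at u) k                     ≡⟨ count-window translated-support fits ⟩
    count (λ i → at u (c + i)) (suc s) ≡⟨ count-cong {λ i → at u (c + i)} {λ i → at v (a + i)} (suc s) shifted ⟩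
    count (λ i → at v (a + i)) (suc s) ≡⟨ count-window support a+s<k ⟨
    count (at v) k                     ≡⟨ ∣∣≡count v ⟨
    ∣ v ∣                              ∎
    where
      open ≡-Reasoning
      shifted : ∀ i → i < suc s → at u (c + i) ≡ at v (a + i)
      shifted i (s≤s i≤s) = at-translateTo-+ v (≤-<-trans (+-monoʳ-≤ c i≤s) fits)
      a+s<k : a + s < k
      a+s<k = subst (_< k) (sym least+spread) (at⇒< v b (greatest-at v v∋j₀))

  translateTo-inverse : translateTo u a ≡ v
  translateTo-inverse = at-ext (translateTo u a) v same
    where
      shifted-back : ∀ i → at u (c + i) ≡ at v (a + i)
      shifted-back i with c + i <? k
      ... | yes inside  = at-translateTo-+ v inside
      ... | no  outside =
        trans (at-≥ u (c + i) (≮⇒≥ outside)) (sym (¬-not λ vai → outside (≤-<-trans (+-monoʳ-≤ c (i≤s vai)) fits)))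
        where
          i≤s : at v (a + i) ≡ true → i ≤ s
          i≤s vai = +-cancelˡ-≤ a i s (proj₂ (support (a + i) vai))
      same : ∀ j → j < k → at (translateTo u a) j ≡ at v j
      same j j<k with a ≤? j
      ... | no  a≰j = trans (at-translateTo-< u (≰⇒> a≰j)) (sym (¬-not λ vj → a≰j (proj₁ (support j vj))))
      ... | yes a≤j = begin
        at (translateTo u a) j     ≡⟨ at-translateTo-≥ u a≤j j<k ⟩
        at u (least u + (j ∸ a))   ≡⟨ cong (λ t → at u (t + (j ∸ a))) least-translateTo ⟩
        at u (c + (j ∸ a))         ≡⟨ shifted-back (j ∸ a) ⟩
        at v (a + (j ∸ a))         ≡⟨ cong (at v) (m+[n∸m]≡n a≤j) ⟩
        at v j                     ∎
        where open ≡-Reasoning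

module _ {A : Set} where

  sum-map-─ : ∀ (w : A → ℕ) xs {m} (m∈ : m ∈ xs) → sum (map w xs) ≡ w m + sum (map w (xs ─ m∈))
  sum-map-─ w (x ∷ xs) (here refl) = refl
  sum-map-─ w (x ∷ xs) {m} (there m∈) = trans (cong (w x +_) (sum-map-─ w xs m∈)) (x∙yz≈y∙xz (w x) (w m) _)

  AllPairs-─⁺ : ∀ {R : Rel A 0ℓ} {xs m} (m∈ : m ∈ xs) → AllPairs R xs → AllPairs R (xs ─ m∈)
  AllPairs-─⁺ (here refl) (_ ∷ rs)  = rs
  AllPairs-─⁺ (there m∈)  (r ∷ rs) = All.─⁺ m∈ r ∷ AllPairs-─⁺ m∈ rs

  AllPairs⇒All-─ : ∀ {R : Rel A 0ℓ} → Symmetric R → ∀ {xs m} (m∈ : m ∈ xs) → AllPairs R xs → All (R m) (xs ─ m∈)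
  AllPairs⇒All-─ sym (here refl) (r ∷ _)  = r
  AllPairs⇒All-─ sym (there m∈)  (r ∷ rs) = sym (All.lookup r m∈) ∷ AllPairs⇒All-─ sym m∈ rs

-- Comparability graphs and their cliques

Adjacent : ∀ {n} → FinPoset n → Fin n → Fin n → Set
Adjacent P x y = ¬ (x ≡ y) × Comparable P x y

Adjacent-sym : ∀ {n} (P : FinPoset n) → Symmetric (Adjacent P)
Adjacent-sym P (x≢y , inj₁ x≼y) = (λ y≡x → x≢y (sym y≡x)) , inj₂ x≼y
Adjacent-sym P (x≢y , inj₂ y≼x) = (λ y≡x → x≢y (sym y≡x)) , inj₁ y≼x

Clique : ∀ {n} → FinPoset n → List (Fin n) → Set
Clique P = AllPairs (Adjacent P)

module Poset {n} (P : FinPoset n) where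

  private
    module ≼ = IsPartialOrder (isPartialOrder P)

  infix 4 _⊑_ _⊏_

  _⊑_ : Rel (Fin n) _
  _⊑_ = _≼_ P

  _⊏_ : Rel (Fin n) _
  _⊏_ = ToStrict._<_ _≡_ _⊑_

  _⊏?_ : Decidable _⊏_
  x ⊏? y = _≼?_ P x y ×-dec ¬? (x ≟ᶠ y)

  ⊏-trans : ∀ {x y z} → x ⊏ y → y ⊏ z → x ⊏ z
  ⊏-trans = ToStrict.<-trans _≡_ _⊑_ (isPartialOrder P)

  ⊏-wellFounded : WellFounded _⊏_
  ⊏-wellFounded = po-wellFounded (isPartialOrder P)

  ⊏⇒Adjacent : ∀ {x y} → x ⊏ y → Adjacent P y x
  ⊏⇒Adjacent (x⊑y , x≢y) = (λ y≡x → x≢y (sym y≡x)) , inj₂ x⊑y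

  below : Fin n → List (Fin n)
  below p = filter (_⊏? p) (allFin n)

  ∈below⁻ : ∀ {y p} → y ∈ below p → y ⊏ p
  ∈below⁻ {p = p} y∈ = proj₂ (∈-filter⁻ (_⊏? p) {xs = allFin n} y∈)

  maxBelow : (Fin n → ℕ) → Fin n → ℕ
  maxBelow f p = max 0 (map f (below p))

  ≤maxBelow : ∀ f {y p} → y ⊏ p → f y ≤ maxBelow f p
  ≤maxBelow f {y} {p} y⊏p = All.lookup (xs≤max 0 (map f (below p))) (∈-map⁺ f (∈-filter⁺ (_⊏? p) (∈-allFin y) y⊏p))

  maxBelow≤ : ∀ f {p c} → (∀ y → y ⊏ p → f y ≤ c) → maxBelow f p ≤ c
  maxBelow≤ f {p} bound = max≤v⁺ z≤n (All.map⁺ (All.tabulate (λ {y} y∈ → bound y (∈below⁻ y∈))))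

  maxBelow-cong : ∀ {f g} p → (∀ y → y ⊏ p → f y ≡ g y) → maxBelow f p ≡ maxBelow g p
  maxBelow-cong p f≡g = cong (max 0) (map-cong-local (All.tabulate (λ y∈ → f≡g _ (∈below⁻ y∈))))

  maxBelow-attained : ∀ f p → maxBelow f p ≡ 0 ⊎ ∃ λ y → y ⊏ p × maxBelow f p ≡ f y
  maxBelow-attained f p with argmax-sel (λ x → x) 0 (map f (below p))
  ... | inj₁ ≡0 = inj₁ ≡0
  ... | inj₂ ∈fs with ∈-map⁻ f ∈fs
  ...   | y , y∈ , ≡fy = inj₂ (y , ∈below⁻ y∈ , ≡fy)

  clique-top : ∀ {x xs} → Clique P (x ∷ xs) → ∃ λ m → m ∈ x ∷ xs × All (_⊑ m) (x ∷ xs)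
  clique-top {x} {[]}     _            = x , here refl , ≼.refl ∷ []
  clique-top {x} {y ∷ ys} (x~ ∷ rest) with clique-top rest
  ... | m , m∈ , ys⊑m with All.lookup x~ m∈
  ...   | _ , inj₁ x⊑m = m , there m∈ , x⊑m ∷ ys⊑m
  ...   | _ , inj₂ m⊑x = x , here refl , ≼.refl ∷ All.map (λ z⊑m → ≼.trans z⊑m m⊑x) ys⊑m

  module Heaviest (w : Fin n → ℕ) where

    private
      step : ∀ p → WfRec _⊏_ (λ _ → ℕ) p → ℕ
      step p rec = w p + max 0 (mapWith∈ (below p) (λ y∈ → rec (∈below⁻ y∈)))

      module Unfold = WF.FixPoint ⊏-wellFounded (λ _ → ℕ) step
        (λ p rec≡ → cong (λ ys → w p + max 0 ys) (mapWith∈-cong (below p) _ _ (λ y∈ → rec≡ (∈below⁻ y∈))))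

    heaviest : Fin n → ℕ
    heaviest = WF.All.wfRec ⊏-wellFounded _ (λ _ → ℕ) step

    heaviest-unfold : ∀ p → heaviest p ≡ w p + maxBelow heaviest p
    heaviest-unfold p = trans Unfold.unfold-wfRec (cong (λ ys → w p + max 0 ys) (mapWith∈≗map heaviest (below p)))

    heaviest-unique : ∀ (G : Fin n → ℕ) → (∀ p → G p ≡ w p + maxBelow G p) → ∀ p → G p ≡ heaviest p
    heaviest-unique G G-unfold p = go (⊏-wellFounded p)
      where
        go : ∀ {p} → Acc _⊏_ p → G p ≡ heaviest p
        go {p} (acc rs) = begin
          G p                       ≡⟨ G-unfold p ⟩
          w p + maxBelow G p        ≡⟨ cong (w p +_) (maxBelow-cong p (λ _ y⊏p → go (rs y⊏p))) ⟩
          w p + maxBelow heaviest p ≡⟨ heaviest-unfold p ⟨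
          heaviest p                ∎
          where open ≡-Reasoning

    weight : List (Fin n) → ℕ
    weight xs = sum (map w xs)

    heaviest-chain : ∀ {p} → Acc _⊏_ p → ∃ λ xs → Clique P (p ∷ xs) × All (_⊏ p) xs × w p + weight xs ≡ heaviest p
    heaviest-chain {p} (acc rs) with maxBelow-attained heaviest p
    ... | inj₁ max≡0 = [] , [] ∷ [] , [] , trans (cong (w p +_) (sym max≡0)) (sym (heaviest-unfold p))
    ... | inj₂ (y , y⊏p , max≡hy) with heaviest-chain (rs y⊏p)
    ...   | ys , cl , ys⊏y , chain≡hy =
      y ∷ ys , All.map ⊏⇒Adjacent (y⊏p ∷ ys⊏p) ∷ cl , y⊏p ∷ ys⊏p ,
      trans (cong (w p +_) (trans chain≡hy (sym max≡hy))) (sym (heaviest-unfold p))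
      where
        ys⊏p = All.map (λ z⊏y → ⊏-trans z⊏y y⊏p) ys⊏y

    heaviest-attained : ∀ p → ∃ λ xs → Clique P xs × weight xs ≡ heaviest p
    heaviest-attained p with heaviest-chain (⊏-wellFounded p)
    ... | xs , cl , _ , chain≡hp = p ∷ xs , cl , chain≡hp

    mutual
      weight≤heaviest : ∀ {m xs} → Acc _⊏_ m → Clique P xs → (m∈ : m ∈ xs) → All (_⊑ m) xs → weight xs ≤ heaviest m
      weight≤heaviest {m} {xs} a cl m∈ xs⊑m = begin
        weight xs                  ≡⟨ sum-map-─ w xs m∈ ⟩
        w m + weight (xs ─ m∈)     ≤⟨ +-monoʳ-≤ (w m) (weight≤maxBelow a (AllPairs-─⁺ m∈ cl) rest⊏m) ⟩
        w m + maxBelow heaviest m  ≡⟨ heaviest-unfold m ⟨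
        heaviest m                 ∎
        where
          open ≤-Reasoning
          rest⊏m : All (_⊏ m) (xs ─ m∈)
          rest⊏m = All.zipWith (λ (z⊑m , (m≢z , _)) → z⊑m , λ z≡m → m≢z (sym z≡m))
                     (All.─⁺ m∈ xs⊑m , AllPairs⇒All-─ (Adjacent-sym P) m∈ cl)

      weight≤maxBelow : ∀ {p ys} → Acc _⊏_ p → Clique P ys → All (_⊏ p) ys → weight ys ≤ maxBelow heaviest p
      weight≤maxBelow _        _  []            = z≤n
      weight≤maxBelow (acc rs) cl ys⊏p@(_ ∷ _) with clique-top cl
      ... | m , m∈ , ys⊑m =
        ≤-trans (weight≤heaviest (rs (All.lookup ys⊏p m∈)) cl m∈ ys⊑m) (≤maxBelow heaviest (All.lookup ys⊏p m∈))

    clique-weight≤ : ∀ {c} → (∀ p → heaviest p ≤ c) → ∀ {xs} → Clique P xs → weight xs ≤ c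
    clique-weight≤ _     {[]}    _  = z≤n
    clique-weight≤ bound {_ ∷ _} cl with clique-top cl
    ... | m , m∈ , xs⊑m = ≤-trans (weight≤heaviest (⊏-wellFounded m) cl m∈ xs⊑m) (bound m)

-- The transfer map between set-valued partitions of two posets on the same ground set

rise : ∀ {n ℓ} → FinPoset n → SetMap n ℓ → Fin n → ℕ
rise P T p = (least (lookup T p) ∸ Poset.maxBelow P (greatest ∘ lookup T) p) + spread (lookup T p)

transfer : ∀ {n ℓ} → FinPoset n → FinPoset n → SetMap n ℓ → SetMap n ℓ
transfer P Q T = tabulate λ p →
  translateTo (lookup T p) (Poset.Heaviest.heaviest Q (rise P T) p ∸ spread (lookup T p))

module SetValuedPPartition {n ℓ} (P : FinPoset n) {T : SetMap n ℓ} (T∈ : IsSetValuedPPartition ℓ P T) where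

  open Poset P

  nonempty : ∀ p → ∃ λ j → at (lookup T p) j ≡ true
  nonempty p = nonempty⇒at (proj₁ T∈ p)

  maxBelow-greatest≤least : ∀ p → maxBelow (greatest ∘ lookup T) p ≤ least (lookup T p)
  maxBelow-greatest≤least p = maxBelow≤ _ λ q (q⊑p , q≢p) →
    maxLeMin⇒greatest≤least _ _ (proj₁ T∈ q) (proj₁ T∈ p) (proj₂ T∈ q p q≢p q⊑p)

  rise-unfold : ∀ p → greatest (lookup T p) ≡ rise P T p + maxBelow (greatest ∘ lookup T) p
  rise-unfold p = sym (begin
    a ∸ B + s + B   ≡⟨ xy∙z≈xz∙y (a ∸ B) s B ⟩
    a ∸ B + B + s   ≡⟨ cong (_+ s) (m∸n+n≡m (maxBelow-greatest≤least p)) ⟩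
    a + s           ≡⟨ m+[n∸m]≡n (least≤greatest (lookup T p) (proj₂ (nonempty p))) ⟩
    greatest (lookup T p) ∎)
    where
      open ≡-Reasoning
      a = least (lookup T p)
      s = spread (lookup T p)
      B = maxBelow (greatest ∘ lookup T) p

  greatest≡heaviest-rise : ∀ p → greatest (lookup T p) ≡ Heaviest.heaviest (rise P T) p
  greatest≡heaviest-rise = Heaviest.heaviest-unique (rise P T) (greatest ∘ lookup T) rise-unfold

  greatest≤ℓ : ∀ p → greatest (lookup T p) ≤ ℓ
  greatest≤ℓ p = ≤-pred (at⇒< (lookup T p) _ (greatest-at (lookup T p) (proj₂ (nonempty p))))

  heaviest-rise≤ℓ : ∀ (Q : FinPoset n) → (∀ {x y} → Adjacent Q x y → Adjacent P x y) →
                    ∀ p → Poset.Heaviest.heaviest Q (rise P T) p ≤ ℓ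
  heaviest-rise≤ℓ Q Q⇒P p with Poset.Heaviest.heaviest-attained Q (rise P T) p
  ... | xs , cl , weight≡ = subst (_≤ ℓ) weight≡
    (Heaviest.clique-weight≤ (rise P T) (λ q → subst (_≤ ℓ) (greatest≡heaviest-rise q) (greatest≤ℓ q))
      (AllPairs.map Q⇒P cl))

module TransferProperties {n ℓ} (P Q : FinPoset n) (Q⇒P : ∀ {x y} → Adjacent Q x y → Adjacent P x y)
                          {T : SetMap n ℓ} (T∈ : IsSetValuedPPartition ℓ P T) where

  private
    module P = Poset P
    module Q = Poset Q
    module Part = SetValuedPPartition P {T} T∈

    T′ : SetMap n ℓ
    T′ = transfer P Q T

    w : Fin n → ℕ
    w = rise P T

    M : Fin n → ℕ
    M = Q.Heaviest.heaviest w

    s : Fin n → ℕ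
    s p = spread (lookup T p)

    c : Fin n → ℕ
    c p = M p ∸ s p

    M-unfold : ∀ p → M p ≡ w p + Q.maxBelow M p
    M-unfold = Q.Heaviest.heaviest-unfold w

    s≤w : ∀ p → s p ≤ w p
    s≤w p = m≤n+m (s p) _

    c+s≡M : ∀ p → c p + s p ≡ M p
    c+s≡M p = m∸n+n≡m (≤-trans (s≤w p) (≤-trans (m≤m+n (w p) _) (≤-reflexive (sym (M-unfold p)))))

    maxBelow≤c : ∀ p → Q.maxBelow M p ≤ c p
    maxBelow≤c p = m+n≤o⇒m≤o∸n X (begin
      X + s p ≤⟨ +-monoʳ-≤ X (s≤w p) ⟩
      X + w p ≡⟨ +-comm X (w p) ⟩
      w p + X ≡⟨ M-unfold p ⟨
      M p     ∎)
      where
        open ≤-Reasoning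
        X = Q.maxBelow M p

    fits : ∀ p → c p + s p < suc ℓ
    fits p = s≤s (subst (_≤ ℓ) (sym (c+s≡M p)) (Part.heaviest-rise≤ℓ Q Q⇒P p))

    module Translate (p : Fin n) = Translation (lookup T p) (proj₂ (Part.nonempty p)) (c p) (fits p)

    lookup-transfer : ∀ p → lookup T′ p ≡ translateTo (lookup T p) (c p)
    lookup-transfer p = lookup∘tabulate _ p

    least-transfer : ∀ p → least (lookup T′ p) ≡ c p
    least-transfer p = trans (cong least (lookup-transfer p)) (Translate.least-translateTo p)

    greatest-transfer : ∀ p → greatest (lookup T′ p) ≡ M p
    greatest-transfer p = trans (cong greatest (lookup-transfer p)) (trans (Translate.greatest-translateTo p) (c+s≡M p))

    spread-transfer : ∀ p → spread (lookup T′ p) ≡ s p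
    spread-transfer p = begin
      greatest (lookup T′ p) ∸ least (lookup T′ p) ≡⟨ cong₂ _∸_ (greatest-transfer p) (least-transfer p) ⟩
      M p ∸ (M p ∸ s p)                            ≡⟨ cong (_∸ (M p ∸ s p)) (c+s≡M p) ⟨
      (c p + s p) ∸ c p                            ≡⟨ m+n∸m≡n (c p) (s p) ⟩
      s p                                          ∎
      where open ≡-Reasoning

  isSetValuedPPartition-transfer : IsSetValuedPPartition ℓ Q T′
  isSetValuedPPartition-transfer = nonempty′ , ordered
    where
      nonempty′ : ∀ p → Nonempty (lookup T′ p)
      nonempty′ p = at⇒nonempty (lookup T′ p) (trans (cong (λ v → at v (c p)) (lookup-transfer p)) (Translate.translated∋c p))
      ordered : ∀ q p → ¬ (q ≡ p) → _≼_ Q q p → MaxLeMin (lookup T′ q) (lookup T′ p)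
      ordered q p q≢p q⊑p = greatest≤least⇒maxLeMin (lookup T′ q) (lookup T′ p) (begin
        greatest (lookup T′ q) ≡⟨ greatest-transfer q ⟩
        M q                    ≤⟨ Q.≤maxBelow M (q⊑p , q≢p) ⟩
        Q.maxBelow M p         ≤⟨ maxBelow≤c p ⟩
        c p                    ≡⟨ least-transfer p ⟨
        least (lookup T′ p)    ∎)
        where open ≤-Reasoning

  excess-transfer : excess T′ ≡ excess T
  excess-transfer = cong sum (map-cong (λ p → cong (_∸ 1) (∣transfer∣ p)) (allFin n))
    where
      ∣transfer∣ : ∀ p → ∣ lookup T′ p ∣ ≡ ∣ lookup T p ∣
      ∣transfer∣ p = trans (cong ∣_∣ (lookup-transfer p)) (Translate.∣translateTo∣ p)

  rise-transfer : ∀ p → rise Q T′ p ≡ w p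
  rise-transfer p = begin
    least (lookup T′ p) ∸ Q.maxBelow (greatest ∘ lookup T′) p + spread (lookup T′ p)
      ≡⟨ cong₂ (λ a B → a ∸ B + spread (lookup T′ p)) (least-transfer p)
               (Q.maxBelow-cong p (λ q _ → greatest-transfer q)) ⟩
    c p ∸ X + spread (lookup T′ p) ≡⟨ cong (c p ∸ X +_) (spread-transfer p) ⟩
    c p ∸ X + s p       ≡⟨ +-∸-comm (s p) (maxBelow≤c p) ⟨
    c p + s p ∸ X       ≡⟨ cong (_∸ X) (trans (c+s≡M p) (M-unfold p)) ⟩
    w p + X ∸ X         ≡⟨ m+n∸n≡m (w p) X ⟩
    w p                 ∎
    where
      open ≡-Reasoning
      X = Q.maxBelow M p

  transfer-inverse : transfer Q P T′ ≡ T
  transfer-inverse = trans (tabulate-cong back) (tabulate∘lookup T)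
    where
      greatest≡heaviest : ∀ p → greatest (lookup T p) ≡ P.Heaviest.heaviest (rise Q T′) p
      greatest≡heaviest = P.Heaviest.heaviest-unique (rise Q T′) (greatest ∘ lookup T)
        (λ p → trans (Part.rise-unfold p) (cong (_+ P.maxBelow (greatest ∘ lookup T) p) (sym (rise-transfer p))))
      back : ∀ p → translateTo (lookup T′ p) (P.Heaviest.heaviest (rise Q T′) p ∸ spread (lookup T′ p)) ≡ lookup T p
      back p = begin
        translateTo (lookup T′ p) (P.Heaviest.heaviest (rise Q T′) p ∸ spread (lookup T′ p))
          ≡⟨ cong₂ translateTo (lookup-transfer p) (cong₂ _∸_ (sym (greatest≡heaviest p)) (spread-transfer p)) ⟩
        translateTo (translateTo (lookup T p) (c p)) (greatest (lookup T p) ∸ s p)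
          ≡⟨ cong (translateTo (translateTo (lookup T p) (c p)))
                  (m∸[m∸n]≡n (least≤greatest (lookup T p) (proj₂ (Part.nonempty p)))) ⟩
        translateTo (translateTo (lookup T p) (c p)) (least (lookup T p))
          ≡⟨ Translate.translateTo-inverse p ⟩
        lookup T p ∎
        where open ≡-Reasoning

module _ {A B : Set} where

  Unique-map⁺-on : ∀ {PA : Pred A 0ℓ} {f : A → B} → (∀ {x y} → PA x → PA y → f x ≡ f y → x ≡ y) →
                   ∀ {zs} → Unique zs → All PA zs → Unique (map f zs)
  Unique-map⁺-on inj []          []          = []
  Unique-map⁺-on inj (z∉ ∷ uniq) (pz ∷ pzs) =
    All.map⁺ (All.zipWith (λ (z≢y , py) fz≡fy → z≢y (inj pz py fz≡fy)) (z∉ , pzs)) ∷ Unique-map⁺-on inj uniq pzs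

  length-filter-bijection :
    ∀ {PA : Pred A 0ℓ} {PB : Pred B 0ℓ} (PA? : U.Decidable PA) (PB? : U.Decidable PB) {xs ys} →
    (∀ a → a ∈ xs) → (∀ b → b ∈ ys) → Unique xs → Unique ys →
    (f : A → B) (g : B → A) → (∀ {a} → PA a → PB (f a)) → (∀ {b} → PB b → PA (g b)) →
    (∀ {a} → PA a → g (f a) ≡ a) → (∀ {b} → PB b → f (g b) ≡ b) →
    length (filter PA? xs) ≡ length (filter PB? ys)
  length-filter-bijection PA? PB? {xs} {ys} all-xs all-ys uniq-xs uniq-ys f g f∈ g∈ gf fg =
    trans (sym (length-map f (filter PA? xs)))
      (↭-length (∼bag⇒↭ (unique∧set⇒bag uniq-image (Unique.filter⁺ PB? uniq-ys) (mk⇔ image⊆ ⊆image))))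
    where
      uniq-image : Unique (map f (filter PA? xs))
      uniq-image = Unique-map⁺-on (λ pa pa′ fa≡fa′ → trans (sym (gf pa)) (trans (cong g fa≡fa′) (gf pa′)))
                     (Unique.filter⁺ PA? uniq-xs) (All.all-filter PA? xs)
      image⊆ : ∀ {b} → b ∈ map f (filter PA? xs) → b ∈ filter PB? ys
      image⊆ b∈ with ∈-map⁻ f b∈
      ... | a , a∈ , refl = ∈-filter⁺ PB? (all-ys (f a)) (f∈ (proj₂ (∈-filter⁻ PA? {xs = xs} a∈)))
      ⊆image : ∀ {b} → b ∈ filter PB? ys → b ∈ map f (filter PA? xs)
      ⊆image {b} b∈ = subst (_∈ map f (filter PA? xs)) (fg pb) (∈-map⁺ f (∈-filter⁺ PA? (all-xs (g b)) (g∈ pb)))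
        where pb = proj₂ (∈-filter⁻ PB? {xs = ys} b∈)

∈-allSubsets : ∀ k (v : Subset k) → v ∈ allSubsets k
∈-allSubsets zero    []      = here refl
∈-allSubsets (suc k) (x ∷ v) = ∈-cartesianProductWith⁺ _∷_ (∈-bools x) (∈-allSubsets k v)
  where
    ∈-bools : ∀ x → x ∈ true ∷ false ∷ []
    ∈-bools true  = here refl
    ∈-bools false = there (here refl)

allSubsets-unique : ∀ k → Unique (allSubsets k)
allSubsets-unique zero    = [] ∷ []
allSubsets-unique (suc k) =
  Unique.cartesianProductWith⁺ _∷_ ∷-injective (((λ ()) ∷ []) ∷ [] ∷ []) (allSubsets-unique k)

∈-allSetMaps : ∀ n ℓ (T : SetMap n ℓ) → T ∈ allSetMaps n ℓ
∈-allSetMaps zero    ℓ []      = here refl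
∈-allSetMaps (suc n) ℓ (v ∷ T) = ∈-cartesianProductWith⁺ _∷_ (∈-allSubsets (suc ℓ) v) (∈-allSetMaps n ℓ T)

allSetMaps-unique : ∀ n ℓ → Unique (allSetMaps n ℓ)
allSetMaps-unique zero    ℓ = [] ∷ []
allSetMaps-unique (suc n) ℓ =
  Unique.cartesianProductWith⁺ _∷_ ∷-injective (allSubsets-unique (suc ℓ)) (allSetMaps-unique n ℓ)

#PP-bijection : ∀ {n m ℓ e} (P : FinPoset n) (Q : FinPoset m) →
                (f : SetMap n ℓ → SetMap m ℓ) (g : SetMap m ℓ → SetMap n ℓ) →
                (∀ {T} → InPP ℓ e P T → InPP ℓ e Q (f T)) → (∀ {T} → InPP ℓ e Q T → InPP ℓ e P (g T)) →
                (∀ {T} → InPP ℓ e P T → g (f T) ≡ T) → (∀ {T} → InPP ℓ e Q T → f (g T) ≡ T) →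
                #PP ℓ e P ≡ #PP ℓ e Q
#PP-bijection {n} {m} {ℓ} {e} P Q =
  length-filter-bijection (inPP? ℓ e P) (inPP? ℓ e Q) (∈-allSetMaps n ℓ) (∈-allSetMaps m ℓ)
    (allSetMaps-unique n ℓ) (allSetMaps-unique m ℓ)

#PP-sameComparability : ∀ {n} (P Q : FinPoset n) →
                        (∀ {x y} → Adjacent P x y → Adjacent Q x y) → (∀ {x y} → Adjacent Q x y → Adjacent P x y) →
                        ∀ ℓ e → #PP ℓ e P ≡ #PP ℓ e Q
#PP-sameComparability P Q P⇒Q Q⇒P ℓ e =
  #PP-bijection P Q (transfer P Q) (transfer Q P)
    (λ {T} (T∈ , excess≡) → PQ.isSetValuedPPartition-transfer {T} T∈ , trans (PQ.excess-transfer {T} T∈) excess≡)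
    (λ {T} (T∈ , excess≡) → QP.isSetValuedPPartition-transfer {T} T∈ , trans (QP.excess-transfer {T} T∈) excess≡)
    (λ {T} (T∈ , _) → PQ.transfer-inverse {T} T∈)
    (λ {T} (T∈ , _) → QP.transfer-inverse {T} T∈)
  where
    module PQ {T} T∈ = TransferProperties {ℓ = ℓ} P Q Q⇒P {T} T∈
    module QP {T} T∈ = TransferProperties {ℓ = ℓ} Q P P⇒Q {T} T∈

-- Relabelling the ground set

pullback : ∀ {n m} → Fin n ↔ Fin m → FinPoset m → FinPoset n
pullback π Q = record
  { _≼_            = λ x y → _≼_ Q (to x) (to y)
  ; isPartialOrder = record
    { isPreorder = record
      { isEquivalence = isEquivalence
      ; reflexive     = λ { refl → ≼.refl }
      ; trans         = ≼.trans
      }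
    ; antisym = λ x≼y y≼x → Injection.injective (↔⇒↣ π) (≼.antisym x≼y y≼x)
    }
  ; _≼?_ = λ x y → _≼?_ Q (to x) (to y)
  }
  where
    open Inverse π using (to)
    module ≼ = IsPartialOrder (isPartialOrder Q)

relabel : ∀ {n m ℓ} → Fin n ↔ Fin m → SetMap m ℓ → SetMap n ℓ
relabel π T = tabulate (lookup T ∘ Inverse.to π)

module _ {n m} (π : Fin n ↔ Fin m) where

  open Inverse π using (to; from; strictlyInverseˡ)

  to-injective : ∀ {x y} → to x ≡ to y → x ≡ y
  to-injective = Injection.injective (↔⇒↣ π)

  lookup-relabel : ∀ {ℓ} (T : SetMap m ℓ) x → lookup (relabel π T) x ≡ lookup T (to x)
  lookup-relabel T = lookup∘tabulate (lookup T ∘ to)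

  relabel-inverse : ∀ {ℓ} (T : SetMap m ℓ) → relabel (↔-sym π) (relabel π T) ≡ T
  relabel-inverse T = trans (tabulate-cong (λ y → trans (lookup-relabel T (from y)) (cong (lookup T) (strictlyInverseˡ y))))
                            (tabulate∘lookup T)

  isSetValuedPPartition-relabel : ∀ {ℓ} {P : FinPoset n} {Q : FinPoset m} →
                                  (∀ {x y} → _≼_ P x y → _≼_ Q (to x) (to y)) →
                                  ∀ {T} → IsSetValuedPPartition ℓ Q T → IsSetValuedPPartition ℓ P (relabel π T)
  isSetValuedPPartition-relabel P⇒Q {T} (nonempty , ordered) =
    (λ x → subst Nonempty (sym (lookup-relabel T x)) (nonempty (to x))) ,
    (λ x y x≢y x≼y → subst₂ MaxLeMin (sym (lookup-relabel T x)) (sym (lookup-relabel T y))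
                       (ordered (to x) (to y) (x≢y ∘ to-injective) (P⇒Q x≼y)))

  excess-relabel : ∀ {ℓ} (T : SetMap m ℓ) → excess (relabel π T) ≡ excess T
  excess-relabel T = begin
    sum (map (λ x → ∣ lookup (relabel π T) x ∣ ∸ 1) (allFin n))
      ≡⟨ cong sum (map-cong (λ x → cong (λ v → ∣ v ∣ ∸ 1) (lookup-relabel T x)) (allFin n)) ⟩
    sum (map (excessAt ∘ to) (allFin n))                       ≡⟨ cong sum (map-∘ (allFin n)) ⟩
    sum (map excessAt (map to (allFin n)))                     ≡⟨ sum-↭ (Perm.map⁺ excessAt to-allFin↭) ⟩
    sum (map excessAt (allFin m))                              ∎
    where
      open ≡-Reasoning
      excessAt : Fin m → ℕ
      excessAt y = ∣ lookup T y ∣ ∸ 1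
      ∈-image : ∀ y → y ∈ map to (allFin n)
      ∈-image y = subst (_∈ map to (allFin n)) (strictlyInverseˡ y) (∈-map⁺ to (∈-allFin (from y)))
      to-allFin↭ : map to (allFin n) ↭ allFin m
      to-allFin↭ = ∼bag⇒↭ (unique∧set⇒bag (Unique.map⁺ to-injective (Unique.allFin⁺ n)) (Unique.allFin⁺ m)
        (λ {y} → mk⇔ (λ _ → ∈-allFin y) (λ _ → ∈-image y)))

#PP-pullback : ∀ {n m} (π : Fin n ↔ Fin m) (Q : FinPoset m) → ∀ ℓ e → #PP ℓ e (pullback π Q) ≡ #PP ℓ e Q
#PP-pullback π Q ℓ e =
  #PP-bijection (pullback π Q) Q (relabel (↔-sym π)) (relabel π) (λ {T} → forth {T}) (λ {T} → back {T})
    (λ {T} _ → relabel-inverse (↔-sym π) T) (λ {T} _ → relabel-inverse π T)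
  where
    open Inverse π using (strictlyInverseˡ)
    forth : ∀ {T} → InPP ℓ e (pullback π Q) T → InPP ℓ e Q (relabel (↔-sym π) T)
    forth {T} (T∈ , excess≡) =
      isSetValuedPPartition-relabel (↔-sym π) {P = Q} {Q = pullback π Q}
        (λ {x} {y} → subst₂ (_≼_ Q) (sym (strictlyInverseˡ x)) (sym (strictlyInverseˡ y))) {T} T∈ ,
      trans (excess-relabel (↔-sym π) T) excess≡
    back : ∀ {T} → InPP ℓ e Q T → InPP ℓ e (pullback π Q) (relabel π T)
    back {T} (T∈ , excess≡) =
      isSetValuedPPartition-relabel π {P = pullback π Q} {Q = Q} (λ x≼y → x≼y) {T} T∈ ,
      trans (excess-relabel π T) excess≡

proposition3p21 : ∀ {n m} (P : FinPoset n) (Q : FinPoset m) →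
    ComparabilityIso P Q →
    ∀ (ℓ e : ℕ) → ℓ ≥ 1 → #PP ℓ e P ≡ #PP ℓ e Q
-- The argument works for every height.
proposition3p21 P Q (π , preserves) ℓ e _ = begin
  #PP ℓ e P              ≡⟨ #PP-sameComparability P (pullback π Q) P⇒Q Q⇒P ℓ e ⟩
  #PP ℓ e (pullback π Q) ≡⟨ #PP-pullback π Q ℓ e ⟩
  #PP ℓ e Q              ∎
  where
    open ≡-Reasoning
    P⇒Q : ∀ {x y} → Adjacent P x y → Adjacent (pullback π Q) x y
    P⇒Q (x≢y , comparable) = x≢y , proj₁ (preserves _ _ x≢y) comparable
    Q⇒P : ∀ {x y} → Adjacent (pullback π Q) x y → Adjacent P x y
    Q⇒P (x≢y , comparable) = x≢y , proj₂ (preserves _ _ x≢y) comparable
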